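{- Let $\varepsilon\in\{1,-1\}$ and let $q,\ell$ be odd primes such that $2^rq^s=\ell^{2t-1}-\varepsilon$ for some positive integers $r,s,t$. Then $\ell=2^rq^m+\varepsilon$ for some integer $m$ with $0\le m\le s$. -}

module Submission where

-- Write ℓ = 1 + 2c and 2t - 1 = 1 + 2t'.  Put d = ℓ - ε and
-- e = ℓ + ε, so that d · e = ℓ² - 1 and e is even.  Then ℓ^(1+2t') - ε
-- factors over ℕ as d · S, where the cofactor S is built by S₀ = 1 and
-- S_{k+1} = S_k + e · ℓ^(1+2k); in particular S ≡ 1 (mod 2).  The hypothesis
-- therefore reads d · S = 2^r q^s with S odd, and unique factorisation of
-- 2^r q^s forces d = 2^r q^m for some m ≤ s, i.e. ℓ = 2^r q^m + ε.
--
-- The integer statement follows by transporting hypothesis and conclusion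
-- along +_ : ℕ → ℤ.

open import Data.Nat using (ℕ; suc; _≤_; _∸_; s≤s)
import Data.Nat as ℕ
open import Data.Nat.Primality using (Prime)
open import Data.Nat.Divisibility using (_∣_)
open import Data.Product using (∃; _×_; _,_)
open import Data.Sum using (_⊎_; inj₁; inj₂)
open import Relation.Nullary using (¬_)
open import Relation.Binary.PropositionalEquality
  using (_≡_; refl; sym; trans; cong; subst; module ≡-Reasoning)

module Arithmetic where
  open import Data.Nat using (zero; _+_; _*_; _^_; z≤n; NonZero)
  open import Data.Nat.Properties
    using (+-comm; +-assoc; *-assoc; *-comm; *-suc; *-identityˡ; *-identityʳ;
           *-distribˡ-+; +-cancelˡ-≡; *-cancelˡ-≡; m*n≡1⇒m≡1; m≤n⇒m≤1+n)
  open import Data.Nat.Divisibility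
    using (divides; n∣n; m∣m*n; ∣m⇒∣m*n; ∣m∣n⇒∣m+n; ∣m+n∣m⇒∣n)
  open import Data.Nat.Primality using (euclidsLemma; prime[2]; prime⇒nonZero)
  open import Data.Nat.Tactic.RingSolver using (solve-∀)
  open import Data.Empty using (⊥-elim)
  open ≡-Reasoning

  odd⇒1+2* : ∀ n → ¬ (2 ∣ n) → ∃ λ c → n ≡ suc (2 * c)
  odd⇒1+2* zero n-odd = ⊥-elim (n-odd (divides 0 refl))
  odd⇒1+2* (suc zero) _ = 0 , refl
  odd⇒1+2* (suc (suc n)) n-odd with odd⇒1+2* n (λ 2∣n → n-odd (∣m∣n⇒∣m+n n∣n 2∣n))
  ... | c , refl = suc c , cong suc (sym (*-suc 2 c))

  1-odd : ¬ (2 ∣ 1)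
  1-odd (divides zero ())
  1-odd (divides (suc _) ())

  odd-square-minus : ∀ c → 2 * c * (2 + 2 * c) + 1 ≡ suc (2 * c) * suc (2 * c)
  odd-square-minus = solve-∀

  odd-square-plus : ∀ c → (2 + 2 * c) * (2 * c) + 1 ≡ suc (2 * c) * suc (2 * c)
  odd-square-plus = solve-∀

  pull-middle : ∀ a p b → a * p * b ≡ p * (a * b)
  pull-middle = solve-∀

  pull-last : ∀ a b p → a * (b * p) ≡ p * (a * b)
  pull-last = solve-∀

  push-last : ∀ a b p → a * b * p ≡ p * a * b
  push-last = solve-∀

  module _ {p : ℕ} (p-prime : Prime p) where
    private instance
      p-nonZero : NonZero p
      p-nonZero = prime⇒nonZero p-prime

    divisor-of-prime-power : ∀ s d g → d * g ≡ p ^ s → ∃ λ m → m ≤ s × d ≡ p ^ m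
    divisor-of-prime-power zero d g dg≡1 = 0 , z≤n , m*n≡1⇒m≡1 d g dg≡1
    divisor-of-prime-power (suc s) d g dg≡p^s+1
      with euclidsLemma d g p-prime (subst (p ∣_) (sym dg≡p^s+1) (m∣m*n (p ^ s)))
    ... | inj₁ (divides k refl)
      with divisor-of-prime-power s k g
             (*-cancelˡ-≡ (k * g) (p ^ s) p (trans (sym (pull-middle k p g)) dg≡p^s+1))
    ...   | m , m≤s , refl = suc m , s≤s m≤s , *-comm (p ^ m) p
    divisor-of-prime-power (suc s) d g dg≡p^s+1 | inj₂ (divides k refl)
      with divisor-of-prime-power s d k
             (*-cancelˡ-≡ (d * k) (p ^ s) p (trans (sym (pull-last d k p)) dg≡p^s+1))
    ...   | m , m≤s , d≡p^m = m , m≤n⇒m≤1+n m≤s , d≡p^m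

    strip-prime-power : ∀ r d g N → ¬ (p ∣ g) → d * g ≡ p ^ r * N →
                        ∃ λ d' → d ≡ p ^ r * d' × d' * g ≡ N
    strip-prime-power zero d g N _ dg≡N =
      d , sym (*-identityˡ d) , trans dg≡N (*-identityˡ N)
    strip-prime-power (suc r) d g N p∤g dg≡p^r+1N
      with euclidsLemma d g p-prime
             (subst (p ∣_) (sym dg≡p^r+1N) (∣m⇒∣m*n N (m∣m*n (p ^ r))))
    ... | inj₂ p∣g = ⊥-elim (p∤g p∣g)
    ... | inj₁ (divides k refl)
      with strip-prime-power r k g N p∤g
             (*-cancelˡ-≡ (k * g) (p ^ r * N) p
               (trans (sym (pull-middle k p g)) (trans dg≡p^r+1N (*-assoc p (p ^ r) N))))
    ...   | d' , refl , d'g≡N = d' , push-last (p ^ r) d' p , d'g≡N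

  divisor-with-odd-cofactor : ∀ {q : ℕ} → Prime q → ∀ r s d g → ¬ (2 ∣ g) →
                              d * g ≡ 2 ^ r * q ^ s → ∃ λ m → m ≤ s × d ≡ 2 ^ r * q ^ m
  divisor-with-odd-cofactor {q} q-prime r s d g g-odd dg≡2^rq^s
    with strip-prime-power prime[2] r d g (q ^ s) g-odd dg≡2^rq^s
  ... | d' , refl , d'g≡q^s with divisor-of-prime-power q-prime s d' g d'g≡q^s
  ...   | m , m≤s , refl = m , m≤s , refl

  -- The cofactor of x^(1+2t) - ε by d = x - ε, given e = x + ε:
  -- cofactor x e t = 1 + e · (x + x³ + ⋯ + x^(2t-1)).
  cofactor : ℕ → ℕ → ℕ → ℕ
  cofactor x e zero = 1
  cofactor x e (suc t) = cofactor x e t + e * x ^ suc (2 * t)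

  -- Odd powers factor through d: if d · e + 1 = x² and u + x = v + d (that is,
  -- d = x - ε with ε = v - u), then u + x^(1+2t) = v + d · cofactor x e t.
  odd-power-factorisation : ∀ {x d e u v : ℕ} → d * e + 1 ≡ x * x → u + x ≡ v + d →
                            ∀ t → u + x ^ suc (2 * t) ≡ v + d * cofactor x e t
  odd-power-factorisation {x} {d} {e} {u} {v} _ u+x≡v+d zero = begin
    u + x * 1   ≡⟨ cong (u +_) (*-identityʳ x) ⟩
    u + x       ≡⟨ u+x≡v+d ⟩
    v + d       ≡⟨ cong (v +_) (sym (*-identityʳ d)) ⟩
    v + d * 1   ∎
  odd-power-factorisation {x} {d} {e} {u} {v} de+1≡x² u+x≡v+d (suc t) = begin
    u + x ^ suc (2 * suc t)     ≡⟨ cong (λ k → u + x ^ suc k) (*-suc 2 t) ⟩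
    u + x * (x * P)             ≡⟨ cong (u +_) (sym (*-assoc x x P)) ⟩
    u + x * x * P               ≡⟨ cong (λ y → u + y * P) (sym de+1≡x²) ⟩
    u + (d * e + 1) * P         ≡⟨ regroup u d e P ⟩
    (u + P) + d * (e * P)       ≡⟨ cong (_+ d * (e * P)) induction-hypothesis ⟩
    (v + d * S) + d * (e * P)   ≡⟨ +-assoc v (d * S) (d * (e * P)) ⟩
    v + (d * S + d * (e * P))   ≡⟨ cong (v +_) (sym (*-distribˡ-+ d S (e * P))) ⟩
    v + d * (S + e * P)         ∎
    where
    P = x ^ suc (2 * t)
    S = cofactor x e t
    induction-hypothesis : u + P ≡ v + d * S
    induction-hypothesis = odd-power-factorisation {x} {d} {e} {u} {v} de+1≡x² u+x≡v+d t
    regroup : ∀ u d e P → u + (d * e + 1) * P ≡ (u + P) + d * (e * P)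
    regroup = solve-∀

  cofactor-odd : ∀ {x e : ℕ} → 2 ∣ e → ∀ t → ¬ (2 ∣ cofactor x e t)
  cofactor-odd 2∣e zero = 1-odd
  cofactor-odd {x} {e} 2∣e (suc t) 2∣S+eP = cofactor-odd 2∣e t
    (∣m+n∣m⇒∣n (subst (2 ∣_) (+-comm (cofactor x e t) (e * P)) 2∣S+eP) (∣m⇒∣m*n P 2∣e))
    where P = x ^ suc (2 * t)

  theorem-ℕ : ∀ {q : ℕ} → Prime q → ∀ {ℓ d e u v : ℕ} →
              d * e + 1 ≡ ℓ * ℓ → 2 ∣ e → u + ℓ ≡ v + d →
              ∀ r s t → u + ℓ ^ suc (2 * t) ≡ v + 2 ^ r * q ^ s →
              ∃ λ m → m ≤ s × d ≡ 2 ^ r * q ^ m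
  theorem-ℕ q-prime {ℓ} {d} {e} {u} {v} de+1≡ℓ² 2∣e u+ℓ≡v+d r s t hyp =
    divisor-with-odd-cofactor q-prime r s d (cofactor ℓ e t) (cofactor-odd {x = ℓ} 2∣e t)
      (+-cancelˡ-≡ v _ _ (trans (sym factorisation) hyp))
    where
    factorisation : u + ℓ ^ suc (2 * t) ≡ v + d * cofactor ℓ e t
    factorisation = odd-power-factorisation {ℓ} {d} {e} {u} {v} de+1≡ℓ² u+ℓ≡v+d t

open Arithmetic using (odd⇒1+2*; odd-square-minus; odd-square-plus; theorem-ℕ)
open import Data.Nat.Properties using (*-suc)
open import Data.Nat.Divisibility using (n∣n; m∣m*n; ∣m∣n⇒∣m+n)
open import Data.Integer using (ℤ; +_; -_; _+_; _-_; _*_; _^_)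
open import Data.Integer.Properties using (pos-*; +-injective)
open import Data.Integer.Tactic.RingSolver using (solve-∀)
open import Relation.Binary.PropositionalEquality using (cong₂)

pos-^ : ∀ a n → (+ a) ^ n ≡ + (a ℕ.^ n)
pos-^ a ℕ.zero = refl
pos-^ a (suc n) = trans (cong (+ a *_) (pos-^ a n)) (sym (pos-* a (a ℕ.^ n)))

pos-2^r*q^m : ∀ r q m → (+ 2) ^ r * (+ q) ^ m ≡ + (2 ℕ.^ r ℕ.* q ℕ.^ m)
pos-2^r*q^m r q m =
  trans (cong₂ _*_ (pos-^ 2 r) (pos-^ q m)) (sym (pos-* (2 ℕ.^ r) (q ℕ.^ m)))

odd-exponent : ∀ t → 2 ℕ.* suc t ∸ 1 ≡ suc (2 ℕ.* t)
odd-exponent t = cong (_∸ 1) (*-suc 2 t)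

unshift-sign : ∀ a c x y → x ≡ y - (c - a) → a + y ≡ c + x
unshift-sign a c x y x≡y-[c-a] =
  trans (rearrange a c y) (cong (λ z → c + z) (sym x≡y-[c-a]))
  where
  rearrange : ∀ a c y → a + y ≡ c + (y - (c - a))
  rearrange = solve-∀

shift-sign : ∀ a b c d → a + b ≡ c + d → b ≡ d + (c - a)
shift-sign a b c d a+b≡c+d =
  trans (rearrange a b) (trans (cong (_- a) a+b≡c+d) (rearrange′ a c d))
  where
  rearrange : ∀ a b → b ≡ (a + b) - a
  rearrange = solve-∀
  rearrange′ : ∀ a c d → (c + d) - a ≡ d + (c - a)
  rearrange′ = solve-∀

hypothesis-ℕ : ∀ {q ℓ u v : ℕ} r s t →
               (+ 2) ^ r * (+ q) ^ s ≡ (+ ℓ) ^ (2 ℕ.* suc t ∸ 1) - (+ v - + u) →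
               u ℕ.+ ℓ ℕ.^ suc (2 ℕ.* t) ≡ v ℕ.+ 2 ℕ.^ r ℕ.* q ℕ.^ s
hypothesis-ℕ {q} {ℓ} {u} {v} r s t hyp =
  +-injective (unshift-sign (+ u) (+ v) _ (+ (ℓ ℕ.^ suc (2 ℕ.* t))) hyp′)
  where
  hyp′ : + (2 ℕ.^ r ℕ.* q ℕ.^ s) ≡ + (ℓ ℕ.^ suc (2 ℕ.* t)) - (+ v - + u)
  hyp′ = trans (sym (pos-2^r*q^m r q s))
           (trans hyp (cong (_- (+ v - + u))
             (trans (cong ((+ ℓ) ^_) (odd-exponent t)) (pos-^ ℓ (suc (2 ℕ.* t))))))

signed-theorem : ∀ {q} → Prime q → ∀ {ℓ d e u v : ℕ} →
                 d ℕ.* e ℕ.+ 1 ≡ ℓ ℕ.* ℓ → 2 ∣ e → u ℕ.+ ℓ ≡ v ℕ.+ d →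
                 ∀ r s t → (+ 2) ^ r * (+ q) ^ s ≡ (+ ℓ) ^ (2 ℕ.* suc t ∸ 1) - (+ v - + u) →
                 ∃ λ m → m ≤ s × + ℓ ≡ (+ 2) ^ r * (+ q) ^ m + (+ v - + u)
signed-theorem {q} q-prime {ℓ} {d} {e} {u} {v} de+1≡ℓ² 2∣e u+ℓ≡v+d r s t hyp
  with theorem-ℕ q-prime {ℓ} {d} {e} {u} {v} de+1≡ℓ² 2∣e u+ℓ≡v+d r s t (hypothesis-ℕ r s t hyp)
... | m , m≤s , refl =
  m , m≤s , trans (shift-sign (+ u) (+ ℓ) (+ v) (+ (2 ℕ.^ r ℕ.* q ℕ.^ m)) (cong +_ u+ℓ≡v+d))
                  (cong (_+ (+ v - + u)) (sym (pos-2^r*q^m r q m)))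

-- Main theorem: ε = 1 is the sign (u, v) = (0, 1) with d = ℓ - 1, and ε = -1
-- is (u, v) = (1, 0) with d = ℓ + 1.
theorem1p4 : (ε : ℤ) → (ε ≡ + 1 ⊎ ε ≡ - (+ 1)) →
    (q ℓ : ℕ) → Prime q → ¬ (2 ∣ q) → Prime ℓ → ¬ (2 ∣ ℓ) →
    (r s t : ℕ) → 1 ≤ r → 1 ≤ s → 1 ≤ t →
    (+ 2) ^ r * (+ q) ^ s ≡ (+ ℓ) ^ (2 Data.Nat.* t ∸ 1) - ε →
    ∃ λ m → m ≤ s × + ℓ ≡ (+ 2) ^ r * (+ q) ^ m + ε
theorem1p4 ε ε≡±1 q ℓ q-prime _ _ ℓ-odd r s (suc t) _ _ (s≤s _) hyp
  with odd⇒1+2* ℓ ℓ-odd | ε≡±1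
... | c , refl | inj₁ refl =
  signed-theorem q-prime {d = 2 ℕ.* c} {e = 2 ℕ.+ 2 ℕ.* c} {u = 0} {v = 1}
    (odd-square-minus c) (∣m∣n⇒∣m+n n∣n (m∣m*n c)) refl r s t hyp
... | c , refl | inj₂ refl =
  signed-theorem q-prime {d = 2 ℕ.+ 2 ℕ.* c} {e = 2 ℕ.* c} {u = 1} {v = 0}
    (odd-square-plus c) (m∣m*n c) refl r s t hyp
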